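{- Let $G$ be a finite bipartite graph with vertex partition $X\cup Y$, and let $\mathcal{F}^{X}=\{N(y) : y\in Y\}$. A vertex $x\in X$ is rare in $G$ if and only if $x$ is abundant in $\langle \mathcal{F}^{X}\rangle$.
   Context: A stable set of a graph is a set of pairwise non-adjacent vertices; it is maximal if no further vertex can be added while keeping it stable. A vertex $x$ of a finite graph $G$ is rare in $G$ if $x$ lies in at most half of the maximal stable sets of $G$. $N(y)$ denotes the set of neighbours of the vertex $y$. For a finite family of sets $\mathcal{F}$, $\langle\mathcal{F}\rangle$ denotes the union-closed family generated by $\mathcal{F}$: the collection of all unions of subfamilies of $\mathcal{F}$, including the empty set. For a family $\mathcal{U}$, the frequency of an element $x$ is the number of member sets of $\mathcal{U}$ containing $x$, and $x$ is abundant in $\mathcal{U}$ if its frequency is at least $|\mathcal{U}|/2$. -}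

module Defs where

open import Data.Bool using (Bool; true; false; _∧_; _∨_; not; T)
open import Data.Nat using (ℕ; zero; suc; _*_; _≤_)
open import Data.Fin using (Fin)
open import Data.List using (List; []; _∷_; _++_; map; length; filterᵇ)
open import Data.Bool.ListAction using () renaming (all to allL; any to anyL)
open import Data.Vec using (Vec; []; _∷_; lookup; allFin; toList)
open import Data.Vec.Properties using () renaming (≡-dec to vec-≡-dec)
open import Data.Bool.Properties using () renaming (_≟_ to _≟ᵇ_)
open import Relation.Nullary.Decidable using (⌊_⌋)
open import Relation.Binary.PropositionalEquality using (_≡_)

allᶠ : ∀ {n} → (Fin n → Bool) → Bool
allᶠ {n} p = allL p (toList (allFin n))

anyᶠ : ∀ {n} → (Fin n → Bool) → Bool
anyᶠ {n} p = anyL p (toList (allFin n))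

Subset : ℕ → Set
Subset n = Vec Bool n

_∈ᵇ_ : ∀ {n} → Fin n → Subset n → Bool
x ∈ᵇ S = lookup S x

allSubsets : ∀ n → List (Subset n)
allSubsets zero    = [] ∷ []
allSubsets (suc n) = map (true ∷_) (allSubsets n) ++ map (false ∷_) (allSubsets n)

_==ˢ_ : ∀ {n} → Subset n → Subset n → Bool
S ==ˢ S' = ⌊ vec-≡-dec _≟ᵇ_ S S' ⌋

-- Number of members of a (duplicate-free) list of sets containing x.
frequency : ∀ {n} → Fin n → List (Subset n) → ℕ
frequency x 𝓤 = length (filterᵇ (x ∈ᵇ_) 𝓤)

record Graph (n : ℕ) : Set where
  field
    adj     : Fin n → Fin n → Bool
    adj-sym : ∀ u v → adj u v ≡ adj v u
    adj-irr : ∀ u → adj u u ≡ false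

open Graph public

isStable : ∀ {n} → Graph n → Subset n → Bool
isStable G S = allᶠ λ u → allᶠ λ v → not (u ∈ᵇ S ∧ v ∈ᵇ S ∧ adj G u v)

insert : ∀ {n} → Fin n → Subset n → Subset n
insert v S = Data.Vec.updateAt S v (λ _ → true)

isMaximalStable : ∀ {n} → Graph n → Subset n → Bool
isMaximalStable G S =
  isStable G S ∧ allᶠ (λ v → v ∈ᵇ S ∨ not (isStable G (insert v S)))

maximalStableSets : ∀ {n} → Graph n → List (Subset n)
maximalStableSets {n} G = filterᵇ (isMaximalStable G) (allSubsets n)

Rare : ∀ {n} → Graph n → Fin n → Set
Rare G x = 2 * frequency x (maximalStableSets G) ≤ length (maximalStableSets G)

-- Bipartite graph with vertex partition X ∪ Y: inX v = true means v ∈ X,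
-- inX v = false means v ∈ Y; every edge joins X to Y.
IsBipartition : ∀ {n} → Graph n → (Fin n → Bool) → Set
IsBipartition G inX = ∀ u v → T (adj G u v) → inX u ≡ not (inX v)

N : ∀ {n} → Graph n → Fin n → Subset n
N G y = Data.Vec.tabulate (λ x → adj G y x)

⋃N : ∀ {n} → Graph n → Subset n → Subset n
⋃N G Tset = Data.Vec.tabulate (λ x → anyᶠ (λ y → y ∈ᵇ Tset ∧ adj G y x))

⊆Y : ∀ {n} → (Fin n → Bool) → Subset n → Bool
⊆Y inX Tset = allᶠ (λ y → not (y ∈ᵇ Tset ∧ inX y))

-- S ∈ ⟨F^X⟩, F^X = { N(y) : y ∈ Y }: S is the union of a subfamily of F^X
-- (the empty subfamily gives ∅).
isInGenerated : ∀ {n} → Graph n → (Fin n → Bool) → Subset n → Bool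
isInGenerated {n} G inX S =
  anyL (λ Tset → ⊆Y inX Tset ∧ (S ==ˢ ⋃N G Tset)) (allSubsets n)

generatedFamily : ∀ {n} → Graph n → (Fin n → Bool) → List (Subset n)
generatedFamily {n} G inX = filterᵇ (isInGenerated G inX) (allSubsets n)

Abundant : ∀ {n} → Fin n → List (Subset n) → Set
Abundant x 𝓤 = length 𝓤 ≤ 2 * frequency x 𝓤

-- For x ∈ X, S ↦ X ∖ S is a bijection from the maximal stable sets of G onto ⟨F^X⟩.
-- A maximal stable set S dominates X ∖ S from S ∩ Y, so X ∖ S = ⋃ {N(y) : y ∈ S ∩ Y};
-- conversely a union U of neighbourhoods is X ∖ S for the maximal stable set
-- S = (X ∖ U) ∪ (Y ∖ N(X ∖ U)). As x ∈ S iff x ∉ X ∖ S, the number of maximal stable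
-- sets containing x equals the number of members of ⟨F^X⟩ avoiding x, and the two
-- families have the same size; so x is rare exactly when it is abundant.
module Submission where

open import Defs
open import Data.Bool using (Bool; true; false; T; not; _∧_; _∨_)
open import Data.Bool.Properties using (T?; T-∧; T-∨)
open import Data.Nat using (zero; suc; _+_; _*_; _≤_; z≤n; s≤s)
open import Data.Nat.Properties
  using (+-suc; +-comm; +-identityʳ; +-cancelˡ-≤; +-cancelʳ-≤; +-monoˡ-≤; +-monoʳ-≤; ≤-antisym)
open import Data.Fin using (Fin)
open import Data.Fin.Properties using (_≟_)
open import Data.List using (List; []; _∷_; _++_; map; length; filterᵇ)
open import Data.List.Properties using (length-++)
open import Data.List.Membership.Propositional using (_∈_; lose)
open import Data.List.Membership.Propositional.Properties
  using (∈-∃++; ∈-++⁻; ∈-++⁺ˡ; ∈-++⁺ʳ; ∈-map⁺; ∈-map⁻; ∈-filter⁺; ∈-filter⁻)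
open import Data.List.Relation.Unary.Any using (here; there; satisfied)
import Data.List.Relation.Unary.All as All
open import Data.List.Relation.Unary.Any.Properties using (any⁺; any⁻)
open import Data.List.Relation.Unary.All.Properties using (all⁺; all⁻)
open import Data.List.Relation.Unary.AllPairs using ([]; _∷_)
open import Data.List.Relation.Unary.Unique.Propositional using (Unique)
import Data.List.Relation.Unary.Unique.Propositional.Properties as Unique
open import Data.Vec using (Vec; []; _∷_; lookup; tabulate; toList; allFin)
open import Data.Vec.Properties
  using (lookup∘tabulate; tabulate∘lookup; tabulate-cong; lookup∘updateAt; lookup∘updateAt′)
open import Data.Vec.Membership.Propositional.Properties using (∈-toList⁺; ∈-allFin⁺)
open import Data.Product using (_×_; _,_; proj₁; proj₂; ∃-syntax)
open import Data.Sum using (_⊎_; inj₁; inj₂)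
open import Data.Empty using (⊥-elim)
open import Function using (_∘_; _⇔_; mk⇔; Equivalence)
open import Function.Properties.Equivalence using () renaming (refl to ⇔-refl; sym to ⇔-sym; trans to ⇔-trans)
open import Data.Product.Function.NonDependent.Propositional using (_×-⇔_)
open import Data.Sum.Function.Propositional using (_⊎-⇔_)
open import Function.Related.TypeIsomorphisms using (¬-cong-⇔)
open import Relation.Nullary using (¬_; yes; no; contradiction)
open import Relation.Nullary.Decidable using (decidable-stable; toWitness; fromWitness)
open import Relation.Binary.PropositionalEquality
  using (_≡_; refl; sym; trans; cong; subst; module ≡-Reasoning)

open Equivalence using (to; from)

length-filterᵇ-complement : ∀ {A : Set} (p : A → Bool) (xs : List A) →
  length (filterᵇ p xs) + length (filterᵇ (not ∘ p) xs) ≡ length xs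
length-filterᵇ-complement p [] = refl
length-filterᵇ-complement p (x ∷ xs) with p x
... | true  = cong suc (length-filterᵇ-complement p xs)
... | false = trans (+-suc _ _) (cong suc (length-filterᵇ-complement p xs))

length-∷-middle : ∀ {A : Set} (xs : List A) x ys → length (xs ++ x ∷ ys) ≡ suc (length (xs ++ ys))
length-∷-middle xs x ys = begin
  length (xs ++ x ∷ ys)        ≡⟨ length-++ xs ⟩
  length xs + suc (length ys)  ≡⟨ +-suc (length xs) (length ys) ⟩
  suc (length xs + length ys)  ≡⟨ cong suc (length-++ xs) ⟨
  suc (length (xs ++ ys))      ∎
  where open ≡-Reasoning

length-≤-of-injectiveOn : ∀ {A B : Set} (f : A → B) {xs : List A} {ys : List B} → Unique xs →
  (∀ {a} → a ∈ xs → f a ∈ ys) →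
  (∀ {a b} → a ∈ xs → b ∈ xs → f a ≡ f b → a ≡ b) →
  length xs ≤ length ys
length-≤-of-injectiveOn f {[]} _ _ _ = z≤n
length-≤-of-injectiveOn f {x ∷ xs} (x∉xs ∷ xs-unique) maps-to injective
  with ∈-∃++ (maps-to (here refl))
... | ys₁ , ys₂ , refl = subst (suc (length xs) ≤_) (sym (length-∷-middle ys₁ (f x) ys₂))
        (s≤s (length-≤-of-injectiveOn f xs-unique maps-to′ (λ a∈ b∈ → injective (there a∈) (there b∈))))
  where
  maps-to′ : ∀ {a} → a ∈ xs → f a ∈ ys₁ ++ ys₂
  maps-to′ a∈xs with ∈-++⁻ ys₁ (maps-to (there a∈xs))
  ... | inj₁ fa∈ys₁        = ∈-++⁺ˡ fa∈ys₁
  ... | inj₂ (here fa≡fx)  =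
    contradiction (sym (injective (there a∈xs) (here refl) fa≡fx)) (All.lookup x∉xs a∈xs)
  ... | inj₂ (there fa∈ys₂) = ∈-++⁺ʳ ys₁ fa∈ys₂

record InverseOn {A B : Set} (xs : List A) (ys : List B) : Set where
  field
    forth      : A → B
    back       : B → A
    forth-∈    : ∀ {a} → a ∈ xs → forth a ∈ ys
    back-∈     : ∀ {b} → b ∈ ys → back b ∈ xs
    back∘forth : ∀ {a} → a ∈ xs → back (forth a) ≡ a
    forth∘back : ∀ {b} → b ∈ ys → forth (back b) ≡ b

module _ {A B : Set} {xs : List A} {ys : List B} (inv : InverseOn xs ys) where
  open InverseOn inv

  InverseOn⇒length-≡ : Unique xs → Unique ys → length xs ≡ length ys
  InverseOn⇒length-≡ xs-unique ys-unique = ≤-antisym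
    (length-≤-of-injectiveOn forth xs-unique forth-∈ (injectiveOn back back∘forth))
    (length-≤-of-injectiveOn back ys-unique back-∈ (injectiveOn forth forth∘back))
    where
    injectiveOn : ∀ {C D : Set} {zs : List C} {h : C → D} (k : D → C) → (∀ {c} → c ∈ zs → k (h c) ≡ c) →
      ∀ {c c′} → c ∈ zs → c′ ∈ zs → h c ≡ h c′ → c ≡ c′
    injectiveOn k k∘h c∈ c′∈ hc≡hc′ = trans (sym (k∘h c∈)) (trans (cong k hc≡hc′) (k∘h c′∈))

  InverseOn-filterᵇ : (p : A → Bool) (q : B → Bool) → (∀ {a} → a ∈ xs → p a ≡ q (forth a)) →
    InverseOn (filterᵇ p xs) (filterᵇ q ys)
  InverseOn-filterᵇ p q p≡q∘forth = record
    { forth      = forth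
    ; back       = back
    ; forth-∈    = λ a∈ → let a∈xs , pa = ∈-filter⁻ (T? ∘ p) a∈ in
        ∈-filter⁺ (T? ∘ q) (forth-∈ a∈xs) (subst T (p≡q∘forth a∈xs) pa)
    ; back-∈     = λ b∈ → let b∈ys , qb = ∈-filter⁻ (T? ∘ q) b∈ in
        ∈-filter⁺ (T? ∘ p) (back-∈ b∈ys)
          (subst T (sym (trans (p≡q∘forth (back-∈ b∈ys)) (cong q (forth∘back b∈ys)))) qb)
    ; back∘forth = back∘forth ∘ proj₁ ∘ ∈-filter⁻ (T? ∘ p)
    ; forth∘back = forth∘back ∘ proj₁ ∘ ∈-filter⁻ (T? ∘ q)
    }

2*≤⇔≤2* : ∀ a b {c} → a + b ≡ c → 2 * a ≤ c ⇔ c ≤ 2 * b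
2*≤⇔≤2* a b refl rewrite +-identityʳ a | +-identityʳ b = mk⇔
  (λ a+a≤a+b → +-monoˡ-≤ b (+-cancelˡ-≤ a a b a+a≤a+b))
  (λ a+b≤b+b → +-monoʳ-≤ a (+-cancelʳ-≤ b a b a+b≤b+b))

T-⇔⇒≡ : ∀ {a b} → T a ⇔ T b → a ≡ b
T-⇔⇒≡ {true}  {true}  _   = refl
T-⇔⇒≡ {true}  {false} a⇔b = ⊥-elim (to a⇔b _)
T-⇔⇒≡ {false} {true}  a⇔b = ⊥-elim (from a⇔b _)
T-⇔⇒≡ {false} {false} _   = refl

T-not : ∀ {a} → T (not a) ⇔ (¬ T a)
T-not {true}  = mk⇔ (λ ()) (λ ¬⊤ → ¬⊤ _)
T-not {false} = mk⇔ (λ _ ()) (λ _ → _)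

T-not-∧ : ∀ {a b} → T (not (a ∧ b)) ⇔ (T a → ¬ T b)
T-not-∧ {true}  = mk⇔ (λ ¬b _ → to T-not ¬b) (λ ¬b → from T-not (¬b _))
T-not-∧ {false} = mk⇔ (λ _ ()) (λ _ → _)

T-not-∧∧ : ∀ {a b c} → T (not (a ∧ b ∧ c)) ⇔ (T a → T b → ¬ T c)
T-not-∧∧ {true}  = mk⇔ (λ ¬bc _ → to T-not-∧ ¬bc) (λ ¬bc → from T-not-∧ (¬bc _))
T-not-∧∧ {false} = mk⇔ (λ _ ()) (λ _ → _)

T-stable : ∀ {a} → ¬ ¬ T a → T a
T-stable {a} = decidable-stable (T? a)

allᶠ⇔ : ∀ {n} {p : Fin n → Bool} → T (allᶠ p) ⇔ (∀ i → T (p i))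
allᶠ⇔ {n} {p} = mk⇔
  (λ all-p i → All.lookup (all⁺ p (toList (allFin n)) all-p) (∈-toList⁺ (∈-allFin⁺ i)))
  (λ ∀p → all⁻ p {xs = toList (allFin n)} (All.tabulate (λ {i} _ → ∀p i)))

anyᶠ⇔ : ∀ {n} {p : Fin n → Bool} → T (anyᶠ p) ⇔ (∃[ i ] T (p i))
anyᶠ⇔ {n} {p} = mk⇔
  (λ any-p → satisfied (any⁻ p (toList (allFin n)) any-p))
  (λ (i , pi) → any⁺ p (lose (∈-toList⁺ (∈-allFin⁺ i)) pi))

anyᶠ-∧⇔ : ∀ {n} (p q : Fin n → Bool) → T (anyᶠ (λ i → p i ∧ q i)) ⇔ (∃[ i ] T (p i) × T (q i))
anyᶠ-∧⇔ p q = mk⇔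
  (λ any-pq → let i , pqi = to anyᶠ⇔ any-pq in i , to (T-∧ {p i}) pqi)
  (λ (i , pi , qi) → from anyᶠ⇔ (i , from T-∧ (pi , qi)))

infix 4 _∈ₛ_ _∉ₛ_

_∈ₛ_ : ∀ {n} → Fin n → Subset n → Set
v ∈ₛ S = T (v ∈ᵇ S)

_∉ₛ_ : ∀ {n} → Fin n → Subset n → Set
v ∉ₛ S = ¬ v ∈ₛ S

∈ₛ-tabulate : ∀ {n} (p : Fin n → Bool) {v} → v ∈ₛ tabulate p ⇔ T (p v)
∈ₛ-tabulate p {v} = mk⇔ (subst T (lookup∘tabulate p v)) (subst T (sym (lookup∘tabulate p v)))

Subset-ext : ∀ {n} {S S′ : Subset n} → (∀ v → v ∈ₛ S ⇔ v ∈ₛ S′) → S ≡ S′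
Subset-ext {S = S} {S′} S⇔S′ = begin
  S                  ≡⟨ tabulate∘lookup S ⟨
  tabulate (lookup S)  ≡⟨ tabulate-cong (λ v → T-⇔⇒≡ (S⇔S′ v)) ⟩
  tabulate (lookup S′) ≡⟨ tabulate∘lookup S′ ⟩
  S′                 ∎
  where open ≡-Reasoning

∈-allSubsets : ∀ {n} (S : Subset n) → S ∈ allSubsets n
∈-allSubsets []                = here refl
∈-allSubsets {suc n} (true ∷ S)  = ∈-++⁺ˡ (∈-map⁺ (true ∷_) (∈-allSubsets S))
∈-allSubsets {suc n} (false ∷ S) =
  ∈-++⁺ʳ (map (true ∷_) (allSubsets n)) (∈-map⁺ (false ∷_) (∈-allSubsets S))

allSubsets-unique : ∀ n → Unique (allSubsets n)
allSubsets-unique zero    = All.[] ∷ []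
allSubsets-unique (suc n) = Unique.++⁺ (Unique.map⁺ ∷-injectiveʳ (allSubsets-unique n))
  (Unique.map⁺ ∷-injectiveʳ (allSubsets-unique n)) disjoint
  where
  ∷-injectiveʳ : ∀ {b} {S S′ : Subset n} → Vec._∷_ b S ≡ b ∷ S′ → S ≡ S′
  ∷-injectiveʳ refl = refl
  disjoint : ∀ {S} → ¬ (S ∈ map (true ∷_) (allSubsets n) × S ∈ map (false ∷_) (allSubsets n))
  disjoint (S∈ , S∈′) with ∈-map⁻ (true ∷_) S∈ | ∈-map⁻ (false ∷_) S∈′
  ... | _ , _ , refl | _ , _ , ()

∈-filterᵇ-allSubsets : ∀ {n} {p : Subset n → Bool} {S} → S ∈ filterᵇ p (allSubsets n) ⇔ T (p S)
∈-filterᵇ-allSubsets {n} {p} {S} =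
  mk⇔ (proj₂ ∘ ∈-filter⁻ (T? ∘ p) {xs = allSubsets n}) (∈-filter⁺ (T? ∘ p) (∈-allSubsets S))

filterᵇ-allSubsets-unique : ∀ {n} (p : Subset n → Bool) → Unique (filterᵇ p (allSubsets n))
filterᵇ-allSubsets-unique {n} p = Unique.filter⁺ (T? ∘ p) {xs = allSubsets n} (allSubsets-unique n)

∈-insert-self : ∀ {n} (v : Fin n) S → v ∈ₛ insert v S
∈-insert-self v S = subst T (sym (lookup∘updateAt v {f = λ _ → true} S)) _

∈-insert⁺ : ∀ {n} {u} (v : Fin n) S → u ∈ₛ S → u ∈ₛ insert v S
∈-insert⁺ {u = u} v S u∈S with u ≟ v
... | yes refl = ∈-insert-self v S
... | no  u≢v  = subst T (sym (lookup∘updateAt′ u v u≢v S)) u∈S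

∈-insert⁻ : ∀ {n} {u} (v : Fin n) S → u ∈ₛ insert v S → u ≡ v ⊎ u ∈ₛ S
∈-insert⁻ {u = u} v S u∈ with u ≟ v
... | yes u≡v = inj₁ u≡v
... | no  u≢v = inj₂ (subst T (lookup∘updateAt′ u v u≢v S) u∈)

module _ {n} (G : Graph n) where

  Stable : Subset n → Set
  Stable S = ∀ {u v} → u ∈ₛ S → v ∈ₛ S → ¬ T (adj G u v)

  Dominating : Subset n → Set
  Dominating S = ∀ v → v ∉ₛ S → ∃[ w ] w ∈ₛ S × T (adj G v w)

  MaximalStable : Subset n → Set
  MaximalStable S = Stable S × Dominating S

  adj-symmetric : ∀ {u v} → T (adj G u v) → T (adj G v u)
  adj-symmetric {u} {v} = subst T (adj-sym G u v)

  isStable⇔ : ∀ S → T (isStable G S) ⇔ Stable S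
  isStable⇔ S = mk⇔
    (λ stable {u} {v} → to T-not-∧∧ (to allᶠ⇔ (to allᶠ⇔ stable u) v))
    (λ stable → from allᶠ⇔ λ u → from allᶠ⇔ λ v → from T-not-∧∧ (stable {u} {v}))

  insert-stable-or-adjacent : ∀ S v → Stable S →
    Stable (insert v S) ⊎ ∃[ w ] w ∈ₛ S × T (adj G v w)
  insert-stable-or-adjacent S v stable with T? (anyᶠ λ w → w ∈ᵇ S ∧ adj G v w)
  ... | yes adjacent    = inj₂ (to (anyᶠ-∧⇔ (_∈ᵇ S) (adj G v)) adjacent)
  ... | no  nonadjacent = inj₁ insert-stable
    where
    insert-stable : Stable (insert v S)
    insert-stable {u} {w} u∈ w∈ uw with ∈-insert⁻ v S u∈ | ∈-insert⁻ v S w∈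
    ... | inj₁ refl | inj₁ refl = subst T (adj-irr G u) uw
    ... | inj₁ refl | inj₂ w∈S  = nonadjacent (from (anyᶠ-∧⇔ (_∈ᵇ S) (adj G v)) (w , w∈S , uw))
    ... | inj₂ u∈S  | inj₁ refl = nonadjacent (from (anyᶠ-∧⇔ (_∈ᵇ S) (adj G v)) (u , u∈S , adj-symmetric uw))
    ... | inj₂ u∈S  | inj₂ w∈S  = stable u∈S w∈S uw

  isMaximalStable⇔ : ∀ S → T (isMaximalStable G S) ⇔ MaximalStable S
  isMaximalStable⇔ S = mk⇔ sound complete
    where
    sound : T (isMaximalStable G S) → MaximalStable S
    sound isMaximal = stable , dominating
      where
      stable : Stable S
      stable = to (isStable⇔ S) (proj₁ (to (T-∧ {isStable G S}) isMaximal))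
      dominating : Dominating S
      dominating v v∉S with to (T-∨ {v ∈ᵇ S}) (to allᶠ⇔ (proj₂ (to (T-∧ {isStable G S}) isMaximal)) v)
      ... | inj₁ v∈S                = contradiction v∈S v∉S
      ... | inj₂ insert-not-stable with insert-stable-or-adjacent S v stable
      ...   | inj₁ insert-stable =
        contradiction (from (isStable⇔ (insert v S)) insert-stable) (to T-not insert-not-stable)
      ...   | inj₂ adjacent      = adjacent
    complete : MaximalStable S → T (isMaximalStable G S)
    complete (stable , dominating) = from T-∧ (from (isStable⇔ S) stable , from allᶠ⇔ (from T-∨ ∘ maximal))
      where
      maximal : ∀ v → v ∈ₛ S ⊎ T (not (isStable G (insert v S)))
      maximal v with T? (v ∈ᵇ S)
      ... | yes v∈S = inj₁ v∈S
      ... | no  v∉S = let w , w∈S , vw = dominating v v∉S in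
        inj₂ (from T-not λ insert-stable →
          to (isStable⇔ (insert v S)) insert-stable (∈-insert-self v S) (∈-insert⁺ v S w∈S) vw)

  ∈-maximalStableSets⇔ : ∀ {S} → S ∈ maximalStableSets G ⇔ MaximalStable S
  ∈-maximalStableSets⇔ {S} = ⇔-trans ∈-filterᵇ-allSubsets (isMaximalStable⇔ S)

X-complement : ∀ {n} → (Fin n → Bool) → Subset n → Subset n
X-complement inX S = tabulate λ v → inX v ∧ not (v ∈ᵇ S)

∈-X-complement : ∀ {n} (inX : Fin n → Bool) S {v} → v ∈ₛ X-complement inX S ⇔ (T (inX v) × v ∉ₛ S)
∈-X-complement inX S =
  ⇔-trans (∈ₛ-tabulate (λ v → inX v ∧ not (v ∈ᵇ S))) (⇔-trans T-∧ (⇔-refl ×-⇔ T-not))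

∈⇔∉-X-complement : ∀ {n} (inX : Fin n → Bool) S {v} → T (inX v) → v ∈ₛ S ⇔ v ∉ₛ X-complement inX S
∈⇔∉-X-complement inX S Xv = mk⇔
  (λ v∈S v∈X∖S → proj₂ (to (∈-X-complement inX S) v∈X∖S) v∈S)
  (λ v∉X∖S → T-stable λ v∉S → v∉X∖S (from (∈-X-complement inX S) (Xv , v∉S)))

module _ {n} (G : Graph n) (inX : Fin n → Bool) where

  Generated : Subset n → Set
  Generated U = ∃[ Ys ] (∀ {y} → y ∈ₛ Ys → ¬ T (inX y)) × U ≡ ⋃N G Ys

  ∈-⋃N : ∀ Ys {v} → v ∈ₛ ⋃N G Ys ⇔ (∃[ y ] y ∈ₛ Ys × T (adj G y v))
  ∈-⋃N Ys {v} = ⇔-trans (∈ₛ-tabulate λ x → anyᶠ λ y → y ∈ᵇ Ys ∧ adj G y x)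
    (anyᶠ-∧⇔ (_∈ᵇ Ys) (λ y → adj G y v))

  isInGenerated⇔ : ∀ {U} → T (isInGenerated G inX U) ⇔ Generated U
  isInGenerated⇔ {U} = mk⇔
    (λ isGen → let Ys , t = satisfied (any⁻ _ (allSubsets n) isGen)
                   ⊆Y , U≡ = to (T-∧ {⊆Y inX Ys}) t
               in Ys , (λ {y} → to T-not-∧ (to allᶠ⇔ ⊆Y y)) , toWitness U≡)
    (λ (Ys , Ys⊆Y , U≡) → any⁺ _ (lose (∈-allSubsets Ys)
      (from T-∧ (from allᶠ⇔ (λ y → from T-not-∧ (Ys⊆Y {y})) , fromWitness U≡))))

  ∈-generatedFamily⇔ : ∀ {U} → U ∈ generatedFamily G inX ⇔ Generated U
  ∈-generatedFamily⇔ {U} = ⇔-trans ∈-filterᵇ-allSubsets (isInGenerated⇔ {U})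

  -- Equals (X ∖ U) ∪ (Y ∖ N(X ∖ U)) whenever U ⊆ X.
  X-complement⁻¹ : Subset n → Subset n
  X-complement⁻¹ U = tabulate λ v → not (v ∈ᵇ U) ∧ (inX v ∨ not (v ∈ᵇ ⋃N G (X-complement inX U)))

  ∈-⋃N-X-complement : ∀ U {v} →
    v ∈ₛ ⋃N G (X-complement inX U) ⇔ (∃[ x ] (T (inX x) × x ∉ₛ U) × T (adj G x v))
  ∈-⋃N-X-complement U = ⇔-trans (∈-⋃N (X-complement inX U)) (mk⇔
    (λ (x , x∈ , xv) → x , to (∈-X-complement inX U) x∈ , xv)
    (λ (x , x∈ , xv) → x , from (∈-X-complement inX U) x∈ , xv))

  ∈-X-complement⁻¹ : ∀ U {v} → v ∈ₛ X-complement⁻¹ U ⇔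
    (v ∉ₛ U × (T (inX v) ⊎ ¬ (∃[ x ] (T (inX x) × x ∉ₛ U) × T (adj G x v))))
  ∈-X-complement⁻¹ U = ⇔-trans
    (∈ₛ-tabulate λ v → not (v ∈ᵇ U) ∧ (inX v ∨ not (v ∈ᵇ ⋃N G (X-complement inX U))))
    (⇔-trans T-∧ (T-not ×-⇔
      ⇔-trans T-∨ (⇔-refl ⊎-⇔ ⇔-trans T-not (¬-cong-⇔ (∈-⋃N-X-complement U)))))

module _ {n} (G : Graph n) (inX : Fin n → Bool) (bipartite : IsBipartition G inX) where

  adj-X⇒Y : ∀ {u v} → T (adj G u v) → T (inX u) → ¬ T (inX v)
  adj-X⇒Y {u} {v} uv = to T-not ∘ subst T (bipartite u v uv)

  adj-Y⇒X : ∀ {u v} → T (adj G u v) → ¬ T (inX u) → T (inX v)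
  adj-Y⇒X {u} {v} uv ¬Xu = T-stable (¬Xu ∘ subst T (sym (bipartite u v uv)) ∘ from T-not)

  generated-cover : ∀ {U v} → Generated G inX U → v ∈ₛ U →
    ∃[ y ] ¬ T (inX y) × T (adj G y v) × (∀ {w} → T (adj G y w) → w ∈ₛ U)
  generated-cover {v = v} (Ys , Ys⊆Y , refl) v∈U =
    let y , y∈Ys , yv = to (∈-⋃N G inX Ys) v∈U
    in y , Ys⊆Y y∈Ys , yv , λ yw → from (∈-⋃N G inX Ys) (y , y∈Ys , yw)

  generated-⊆X : ∀ {U v} → Generated G inX U → v ∈ₛ U → T (inX v)
  generated-⊆X U-gen v∈U = let _ , ¬Xy , yv , _ = generated-cover U-gen v∈U in adj-Y⇒X yv ¬Xy

  X-complement-generated : ∀ S → MaximalStable G S → Generated G inX (X-complement inX S)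
  X-complement-generated S (stable , dominating) =
    Y∩S , (λ y∈ → proj₁ (to ∈-Y∩S y∈)) , Subset-ext λ v → mk⇔ (covered v) (uncovered v)
    where
    Y∩S : Subset n
    Y∩S = tabulate λ v → not (inX v) ∧ v ∈ᵇ S
    ∈-Y∩S : ∀ {v} → v ∈ₛ Y∩S ⇔ (¬ T (inX v) × v ∈ₛ S)
    ∈-Y∩S = ⇔-trans (∈ₛ-tabulate λ v → not (inX v) ∧ v ∈ᵇ S) (⇔-trans T-∧ (T-not ×-⇔ ⇔-refl))
    covered : ∀ v → v ∈ₛ X-complement inX S → v ∈ₛ ⋃N G Y∩S
    covered v v∈X∖S =
      let Xv , v∉S = to (∈-X-complement inX S) v∈X∖S
          w , w∈S , vw = dominating v v∉S
      in from (∈-⋃N G inX Y∩S) (w , from ∈-Y∩S (adj-X⇒Y vw Xv , w∈S) , adj-symmetric G vw)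
    uncovered : ∀ v → v ∈ₛ ⋃N G Y∩S → v ∈ₛ X-complement inX S
    uncovered v v∈N =
      let y , y∈Y∩S , yv = to (∈-⋃N G inX Y∩S) v∈N
          ¬Xy , y∈S = to ∈-Y∩S y∈Y∩S
      in from (∈-X-complement inX S) (adj-Y⇒X yv ¬Xy , λ v∈S → stable y∈S v∈S yv)

  X-complement⁻¹-excludes : ∀ U {u y} → T (inX u) → u ∉ₛ U → T (adj G u y) →
    y ∉ₛ X-complement⁻¹ G inX U
  X-complement⁻¹-excludes U Xu u∉U uy y∈ with proj₂ (to (∈-X-complement⁻¹ G inX U) y∈)
  ... | inj₁ Xy         = adj-X⇒Y uy Xu Xy
  ... | inj₂ no-X∖U-nbr = no-X∖U-nbr (_ , (Xu , u∉U) , uy)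

  X-complement⁻¹-maximalStable : ∀ U → Generated G inX U → MaximalStable G (X-complement⁻¹ G inX U)
  X-complement⁻¹-maximalStable U U-gen = stable , dominating
    where
    ∉U : ∀ {v} → v ∈ₛ X-complement⁻¹ G inX U → v ∉ₛ U
    ∉U = proj₁ ∘ to (∈-X-complement⁻¹ G inX U)
    stable : Stable G (X-complement⁻¹ G inX U)
    stable {u} {w} u∈ w∈ uw with T? (inX u)
    ... | yes Xu  = X-complement⁻¹-excludes U Xu (∉U u∈) uw w∈
    ... | no  ¬Xu = X-complement⁻¹-excludes U (adj-Y⇒X uw ¬Xu) (∉U w∈) (adj-symmetric G uw) u∈
    dominating : Dominating G (X-complement⁻¹ G inX U)
    dominating v v∉ with T? (v ∈ᵇ U)
    ... | yes v∈U =
      let y , ¬Xy , yv , N[y]⊆U = generated-cover U-gen v∈U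
          y∈ = from (∈-X-complement⁻¹ G inX U)
                 (¬Xy ∘ generated-⊆X U-gen , inj₂ λ (_ , (_ , x∉U) , xy) → x∉U (N[y]⊆U (adj-symmetric G xy)))
      in y , y∈ , adj-symmetric G yv
    ... | no  v∉U =
      let v∈N[X∖U] = T-stable λ v∉N[X∖U] → v∉ (from (∈-X-complement⁻¹ G inX U)
                       (v∉U , inj₂ (v∉N[X∖U] ∘ from (∈-⋃N-X-complement G inX U))))
          x , (Xx , x∉U) , xv = to (∈-⋃N-X-complement G inX U) v∈N[X∖U]
      in x , from (∈-X-complement⁻¹ G inX U) (x∉U , inj₁ Xx) , adj-symmetric G xv

  X-complement⁻¹∘X-complement : ∀ S → MaximalStable G S → X-complement⁻¹ G inX (X-complement inX S) ≡ S
  X-complement⁻¹∘X-complement S (stable , dominating) = Subset-ext λ v → mk⇔ (recovered v) (retained v)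
    where
    ∈-S⇔∉-X∖S : ∀ {x} → T (inX x) → x ∈ₛ S ⇔ x ∉ₛ X-complement inX S
    ∈-S⇔∉-X∖S = ∈⇔∉-X-complement inX S
    recovered : ∀ v → v ∈ₛ X-complement⁻¹ G inX (X-complement inX S) → v ∈ₛ S
    recovered v v∈ with T? (inX v) | to (∈-X-complement⁻¹ G inX (X-complement inX S)) v∈
    ... | yes Xv  | v∉X∖S , _                = from (∈-S⇔∉-X∖S Xv) v∉X∖S
    ... | no  ¬Xv | _     , inj₁ Xv          = contradiction Xv ¬Xv
    ... | no  ¬Xv | _     , inj₂ no-X∖S-nbr = T-stable λ v∉S →
      let w , w∈S , vw = dominating v v∉S
          Xw = adj-Y⇒X vw ¬Xv
      in no-X∖S-nbr (w , (Xw , to (∈-S⇔∉-X∖S Xw) w∈S) , adj-symmetric G vw)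
    retained : ∀ v → v ∈ₛ S → v ∈ₛ X-complement⁻¹ G inX (X-complement inX S)
    retained v v∈S = from (∈-X-complement⁻¹ G inX (X-complement inX S)) (v∉X∖S , side)
      where
      v∉X∖S : v ∉ₛ X-complement inX S
      v∉X∖S v∈X∖S = proj₂ (to (∈-X-complement inX S) v∈X∖S) v∈S
      side : T (inX v) ⊎ ¬ (∃[ x ] (T (inX x) × x ∉ₛ X-complement inX S) × T (adj G x v))
      side with T? (inX v)
      ... | yes Xv = inj₁ Xv
      ... | no  _  = inj₂ λ (x , (Xx , x∉X∖S) , xv) → stable (from (∈-S⇔∉-X∖S Xx) x∉X∖S) v∈S xv

  X-complement∘X-complement⁻¹ : ∀ U → Generated G inX U → X-complement inX (X-complement⁻¹ G inX U) ≡ U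
  X-complement∘X-complement⁻¹ U U-gen = Subset-ext λ v → mk⇔
    (λ v∈ → let Xv , v∉g = to (∈-X-complement inX (X-complement⁻¹ G inX U)) v∈ in
      T-stable λ v∉U → v∉g (from (∈-X-complement⁻¹ G inX U) (v∉U , inj₁ Xv)))
    (λ v∈U → from (∈-X-complement inX (X-complement⁻¹ G inX U))
      (generated-⊆X U-gen v∈U , λ v∈g → proj₁ (to (∈-X-complement⁻¹ G inX U) v∈g) v∈U))

  maximalStableSets↔generatedFamily : InverseOn (maximalStableSets G) (generatedFamily G inX)
  maximalStableSets↔generatedFamily = record
    { forth      = X-complement inX
    ; back       = X-complement⁻¹ G inX
    ; forth-∈    = λ {S} S∈ → from (∈-generatedFamily⇔ G inX)
        (X-complement-generated S (to (∈-maximalStableSets⇔ G) S∈))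
    ; back-∈     = λ {U} U∈ → from (∈-maximalStableSets⇔ G)
        (X-complement⁻¹-maximalStable U (to (∈-generatedFamily⇔ G inX) U∈))
    ; back∘forth = λ {S} S∈ → X-complement⁻¹∘X-complement S (to (∈-maximalStableSets⇔ G) S∈)
    ; forth∘back = λ {U} U∈ → X-complement∘X-complement⁻¹ U (to (∈-generatedFamily⇔ G inX) U∈)
    }

  length-maximalStableSets : length (maximalStableSets G) ≡ length (generatedFamily G inX)
  length-maximalStableSets = InverseOn⇒length-≡ maximalStableSets↔generatedFamily
    (filterᵇ-allSubsets-unique _) (filterᵇ-allSubsets-unique _)

  frequency-maximalStableSets : ∀ {x} → T (inX x) →
    frequency x (maximalStableSets G) + frequency x (generatedFamily G inX) ≡ length (generatedFamily G inX)
  frequency-maximalStableSets {x} Xx = begin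
    frequency x M + frequency x 𝓤                      ≡⟨ cong (_+ frequency x 𝓤) frequency-M≡avoiding-𝓤 ⟩
    length (filterᵇ (not ∘ (x ∈ᵇ_)) 𝓤) + frequency x 𝓤 ≡⟨ +-comm _ (frequency x 𝓤) ⟩
    frequency x 𝓤 + length (filterᵇ (not ∘ (x ∈ᵇ_)) 𝓤) ≡⟨ length-filterᵇ-complement (x ∈ᵇ_) 𝓤 ⟩
    length 𝓤                                           ∎
    where
    open ≡-Reasoning
    M 𝓤 : List (Subset n)
    M = maximalStableSets G
    𝓤 = generatedFamily G inX
    frequency-M≡avoiding-𝓤 : frequency x M ≡ length (filterᵇ (not ∘ (x ∈ᵇ_)) 𝓤)
    frequency-M≡avoiding-𝓤 = InverseOn⇒length-≡
      (InverseOn-filterᵇ maximalStableSets↔generatedFamily (x ∈ᵇ_) (not ∘ (x ∈ᵇ_))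
        (λ {S} _ → T-⇔⇒≡ (⇔-trans (∈⇔∉-X-complement inX S Xx) (⇔-sym T-not))))
      (Unique.filter⁺ (T? ∘ (x ∈ᵇ_)) (filterᵇ-allSubsets-unique _))
      (Unique.filter⁺ (T? ∘ not ∘ (x ∈ᵇ_)) (filterᵇ-allSubsets-unique _))

proposition2p1 : ∀ {n} (G : Graph n) (inX : Fin n → Bool) → IsBipartition G inX →
    ∀ (x : Fin n) → T (inX x) →
    (Rare G x → Abundant x (generatedFamily G inX)) × (Abundant x (generatedFamily G inX) → Rare G x)
proposition2p1 G inX bipartite x Xx = to rare⇔abundant , from rare⇔abundant
  where
  rare⇔abundant : 2 * frequency x (maximalStableSets G) ≤ length (maximalStableSets G) ⇔
                  Abundant x (generatedFamily G inX)
  rare⇔abundant rewrite length-maximalStableSets G inX bipartite =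
    2*≤⇔≤2* (frequency x (maximalStableSets G)) (frequency x (generatedFamily G inX))
      (frequency-maximalStableSets G inX bipartite Xx)
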